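{- Let $(h(n))_{n\in\mathbb{N}}$ be defined by $h(n)=1$ for all integers $n\le 1$ and $h(n)=h(n-h(n-1))+h(n-2)$ for $n>1$, and let $r(n)\in\{0,1\}$ be the residue of $h(n)$ modulo $2$. Then the sequence $(r(8n+4))_{n\in\mathbb{N}}$ is purely periodic with repeating block $0,1,1,0$, and the sequence $(r(16n+8))_{n\in\mathbb{N}}$ is purely periodic with repeating block $0,0,1,1$. Moreover, for all $n\in\mathbb{N}$: $$r(8n+2)=1-r(8n),\quad r(8n+6)=r(8n+4),\quad r(32n)=r(16n),\quad r(32n+16)=1-r(16n+8).$$ -}

module Defs where

open import Data.Nat using (ℕ; zero; suc; _+_; _∸_; _≤ᵇ_)
open import Data.Nat.DivMod using (_%_)
open import Data.Bool using (if_then_else_)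

-- table n k = h(k) for all k ≤ n  (values for k > n are irrelevant).
-- h(k) = 1 for k ≤ 1 (this also covers all negative integers), and
-- h(N) = h(N - h(N-1)) + h(N-2) for N ≥ 2.
-- Since h ≥ 1, N - h(N-1) ≤ N - 1; if it is ≤ 1 (in particular negative)
-- the value is 1, which the truncated subtraction realises since
-- table n 0 = table n 1 = 1.
table : ℕ → ℕ → ℕ
table zero    = λ _ → 1
table (suc n) = λ k → if k ≤ᵇ n then table n k else new
  where
  N : ℕ
  N = suc n
  new : ℕ
  new = if N ≤ᵇ 1 then 1
        else table n (N ∸ table n n) + table n (N ∸ 2)

h : ℕ → ℕ
h n = table n n

r : ℕ → ℕ
r n = h n % 2

-- The odd terms are explicit, h(2k+1) = k+1, and h(2k) ≥ 2k; proved together by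
-- induction, these make the subtracted index in the recurrence at 2k+2 equal to k+1,
-- so h(2k+2) = h(k+1) + h(2k).  Modulo 2 this recurrence is additive, and unfolding
-- it a few times gives r(8k+12) = (k+1 mod 2) + r(8k+4), whose solution is the
-- 4-periodic block 0,1,1,0.  The other identities are the same unfolding at the
-- indices 8k+2, 8k+6, 16k+8, 32k and 32k+16.
module Submission where

open import Defs
open import Data.Bool using (true; false; T)
open import Data.Nat using (ℕ; zero; suc; _+_; _*_; _∸_; _≤_; _≤ᵇ_; z≤n; s≤s; parity)
open import Data.Nat.DivMod using (_mod_; _%_)
open import Data.Nat.Properties
open import Data.Parity.Base as ℙ using (Parity; 0ℙ; 1ℙ; _⁻¹)
open import Data.Parity.Properties as ℙ using (+-homo-+; suc-homo-⁻¹)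
open import Data.Product using (_×_; _,_; proj₁)
open import Data.Vec using (Vec; []; _∷_; lookup; map)
open import Data.Vec.Properties using (lookup-map)
open import Relation.Binary.PropositionalEquality
open import Relation.Nullary using (contradiction)
open ≡-Reasoning

table-suc : ∀ {n k} → k ≤ n → table (suc n) k ≡ table n k
table-suc {n} {k} k≤n with k ≤ᵇ n | ≤⇒≤ᵇ k≤n
... | true | _ = refl

table-stable : ∀ {n k} → k ≤ n → table n k ≡ h k
table-stable {n} {k} k≤n = subst (λ m → table m k ≡ h k) (m∸n+n≡m k≤n) (stable (n ∸ k))
  where
  stable : ∀ d → table (d + k) k ≡ h k
  stable zero    = refl
  stable (suc d) = trans (table-suc (m≤n+m k d)) (stable d)

table-positive : ∀ n k → 1 ≤ table n k
table-positive zero    k = s≤s z≤n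
table-positive (suc n) k with k ≤ᵇ n
... | true = table-positive n k
... | false with suc n ≤ᵇ 1
...   | true  = s≤s z≤n
...   | false = ≤-trans (table-positive n _) (m≤m+n _ _)

h-positive : ∀ n → 1 ≤ h n
h-positive n = table-positive n n

h-rec : ∀ m → h (2 + m) ≡ h (2 + m ∸ h (1 + m)) + h m
h-rec m = trans new-entry (cong₂ _+_ (table-stable (∸-monoʳ-≤ (2 + m) (h-positive (1 + m))))
                                     (table-stable (n≤1+n m)))
  where
  new-entry : h (2 + m) ≡ table (1 + m) (2 + m ∸ h (1 + m)) + table (1 + m) m
  new-entry with 2 + m ≤ᵇ 1 + m in eq
  ... | true  = contradiction (≤ᵇ⇒≤ (2 + m) (1 + m) (subst T (sym eq) _)) 1+n≰n
  ... | false = refl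

h-≤1 : ∀ {n} → n ≤ 1 → h n ≡ 1
h-≤1 z≤n       = refl
h-≤1 (s≤s z≤n) = refl

2≤h : ∀ m → 2 ≤ h (2 + m)
2≤h m = subst (2 ≤_) (sym (h-rec m)) (+-mono-≤ (h-positive (2 + m ∸ h (1 + m))) (h-positive m))

-- Indices are written c + double (double … k) rather than c + 2ⁱ * k because
-- double (suc k) reduces to suc (suc (double k)): for instance
-- double (double (double (suc k))) is definitionally 8 + double (double (double k)),
-- so the recurrences apply at such indices without any arithmetic.
double : ℕ → ℕ
double zero    = zero
double (suc n) = suc (suc (double n))

double≡+ : ∀ n → double n ≡ n + n
double≡+ zero    = refl
double≡+ (suc n) = cong suc (trans (cong suc (double≡+ n)) (sym (+-suc n n)))

1+double∸ : ∀ k → 1 + double k ∸ k ≡ 1 + k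
1+double∸ k = trans (cong (λ x → suc x ∸ k) (double≡+ k)) (m+n∸n≡m (suc k) k)

h-even-from-odd : ∀ k → h (1 + double k) ≡ 1 + k → h (2 + double k) ≡ h (1 + k) + h (double k)
h-even-from-odd k odd = begin
  h (2 + double k)
    ≡⟨ h-rec (double k) ⟩
  h (2 + double k ∸ h (1 + double k)) + h (double k)
    ≡⟨ cong (λ x → h (2 + double k ∸ x) + h (double k)) odd ⟩
  h (1 + double k ∸ k) + h (double k)
    ≡⟨ cong (λ x → h x + h (double k)) (1+double∸ k) ⟩
  h (1 + k) + h (double k)
    ∎

even-bound-step : ∀ k → double k ≤ h (double k) → double (suc k) ≤ h (1 + k) + h (double k)
even-bound-step zero    _     = ≤-refl
even-bound-step (suc k) bound = +-mono-≤ (2≤h k) bound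

h-odd-and-even-bound : ∀ k → h (1 + double k) ≡ 1 + k × double k ≤ h (double k)
h-odd-and-even-bound zero    = refl , z≤n
h-odd-and-even-bound (suc k) with h-odd-and-even-bound k
... | odd-k , bound-k = odd , even-bound
  where
  even-bound : double (suc k) ≤ h (double (suc k))
  even-bound = subst (double (suc k) ≤_) (sym (h-even-from-odd k odd-k)) (even-bound-step k bound-k)
  subtrahend≤1 : 3 + double k ∸ h (2 + double k) ≤ 1
  subtrahend≤1 = ≤-trans (∸-monoʳ-≤ (3 + double k) even-bound) (≤-reflexive (m+n∸n≡m 1 (2 + double k)))
  odd : h (1 + double (suc k)) ≡ 2 + k
  odd = trans (h-rec (1 + double k)) (cong₂ _+_ (h-≤1 subtrahend≤1) odd-k)

h-odd : ∀ k → h (1 + double k) ≡ 1 + k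
h-odd k = proj₁ (h-odd-and-even-bound k)

h-even : ∀ k → h (2 + double k) ≡ h (1 + k) + h (double k)
h-even k = h-even-from-odd k (h-odd k)

ρ : ℕ → Parity
ρ n = parity (h n)

ρ-odd : ∀ k → ρ (1 + double k) ≡ parity (1 + k)
ρ-odd k = cong parity (h-odd k)

ρ-even : ∀ k → ρ (2 + double k) ≡ ρ (1 + k) ℙ.+ ρ (double k)
ρ-even k = trans (cong parity (h-even k)) (+-homo-+ (h (1 + k)) (h (double k)))

parity-double : ∀ k → parity (double k) ≡ 0ℙ
parity-double zero    = refl
parity-double (suc k) = parity-double k

parity-1+double : ∀ k → parity (1 + double k) ≡ 1ℙ
parity-1+double zero    = refl
parity-1+double (suc k) = parity-1+double k

ρ-4k+2 : ∀ k → ρ (2 + double (double k)) ≡ parity (1 + k) ℙ.+ ρ (double (double k))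
ρ-4k+2 k = trans (ρ-even (double k)) (cong (ℙ._+ ρ (double (double k))) (ρ-odd k))

ρ-8k+2 : ∀ k → ρ (2 + double (double (double k))) ≡ ρ (double (double (double k))) ⁻¹
ρ-8k+2 k = trans (ρ-4k+2 (double k)) (cong (ℙ._+ ρ (double (double (double k)))) (parity-1+double k))

ρ-8k+6 : ∀ k → ρ (6 + double (double (double k))) ≡ ρ (4 + double (double (double k)))
ρ-8k+6 k = trans (ρ-4k+2 (1 + double k)) (cong (ℙ._+ ρ (4 + double (double (double k)))) (parity-double k))

ρ-8k+8 : ∀ k → ρ (8 + double (double (double k)))
             ≡ ρ (4 + double (double k)) ℙ.+ ρ (4 + double (double (double k)))
ρ-8k+8 k = trans (ρ-even (3 + double (double k))) (cong (ρ (4 + double (double k)) ℙ.+_) (ρ-8k+6 k))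

xor-cancel : ∀ p a t → (p ℙ.+ a) ℙ.+ (a ℙ.+ t) ⁻¹ ≡ p ⁻¹ ℙ.+ t
xor-cancel 0ℙ 0ℙ t = refl
xor-cancel 0ℙ 1ℙ 0ℙ = refl
xor-cancel 0ℙ 1ℙ 1ℙ = refl
xor-cancel 1ℙ 0ℙ 0ℙ = refl
xor-cancel 1ℙ 0ℙ 1ℙ = refl
xor-cancel 1ℙ 1ℙ 0ℙ = refl
xor-cancel 1ℙ 1ℙ 1ℙ = refl

ρ-8k+12 : ∀ k → ρ (12 + double (double (double k))) ≡ parity (1 + k) ℙ.+ ρ (4 + double (double (double k)))
ρ-8k+12 k = begin
  ρ (12 + double (double (double k)))
    ≡⟨ ρ-even (5 + double (double k)) ⟩
  ρ (6 + double (double k)) ℙ.+ ρ (10 + double (double (double k)))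
    ≡⟨ cong₂ ℙ._+_ (ρ-4k+2 (suc k)) (trans (ρ-8k+2 (suc k)) (cong _⁻¹ (ρ-8k+8 k))) ⟩
  (parity (2 + k) ℙ.+ a) ℙ.+ (a ℙ.+ t) ⁻¹
    ≡⟨ xor-cancel (parity (2 + k)) a t ⟩
  parity (2 + k) ⁻¹ ℙ.+ t
    ≡⟨ cong (ℙ._+ t) (suc-homo-⁻¹ (suc k)) ⟩
  parity (1 + k) ℙ.+ t
    ∎
  where
  a t : Parity
  a = ρ (4 + double (double k))
  t = ρ (4 + double (double (double k)))

cycle₀₁₁₀ : ℕ → Parity
cycle₀₁₁₀ k = lookup (0ℙ ∷ 1ℙ ∷ 1ℙ ∷ 0ℙ ∷ []) (k mod 4)

cycle₀₁₁₀-suc : ∀ k → cycle₀₁₁₀ (suc k) ≡ parity (1 + k) ℙ.+ cycle₀₁₁₀ k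
cycle₀₁₁₀-suc 0 = refl
cycle₀₁₁₀-suc 1 = refl
cycle₀₁₁₀-suc 2 = refl
cycle₀₁₁₀-suc 3 = refl
cycle₀₁₁₀-suc (suc (suc (suc (suc k)))) = cycle₀₁₁₀-suc k

cycle₀₁₁₀-4k+1 : ∀ k → cycle₀₁₁₀ (1 + double (double k)) ≡ 1ℙ
cycle₀₁₁₀-4k+1 zero    = refl
cycle₀₁₁₀-4k+1 (suc k) = cycle₀₁₁₀-4k+1 k

cycle₀₁₁₀-4k+3 : ∀ k → cycle₀₁₁₀ (3 + double (double k)) ≡ 0ℙ
cycle₀₁₁₀-4k+3 zero    = refl
cycle₀₁₁₀-4k+3 (suc k) = cycle₀₁₁₀-4k+3 k

cycle₀₁₁₀-+-double : ∀ k → cycle₀₁₁₀ k ℙ.+ cycle₀₁₁₀ (double k) ≡ lookup (0ℙ ∷ 0ℙ ∷ 1ℙ ∷ 1ℙ ∷ []) (k mod 4)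
cycle₀₁₁₀-+-double 0 = refl
cycle₀₁₁₀-+-double 1 = refl
cycle₀₁₁₀-+-double 2 = refl
cycle₀₁₁₀-+-double 3 = refl
cycle₀₁₁₀-+-double (suc (suc (suc (suc k)))) = cycle₀₁₁₀-+-double k

ρ-8k+4 : ∀ k → ρ (4 + double (double (double k))) ≡ cycle₀₁₁₀ k
ρ-8k+4 zero    = refl
ρ-8k+4 (suc k) = begin
  ρ (12 + double (double (double k)))                  ≡⟨ ρ-8k+12 k ⟩
  parity (1 + k) ℙ.+ ρ (4 + double (double (double k))) ≡⟨ cong (parity (1 + k) ℙ.+_) (ρ-8k+4 k) ⟩
  parity (1 + k) ℙ.+ cycle₀₁₁₀ k                       ≡⟨ sym (cycle₀₁₁₀-suc k) ⟩
  cycle₀₁₁₀ (suc k)                                    ∎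

ρ-16k+8 : ∀ k → ρ (8 + double (double (double (double k)))) ≡ lookup (0ℙ ∷ 0ℙ ∷ 1ℙ ∷ 1ℙ ∷ []) (k mod 4)
ρ-16k+8 k = begin
  ρ (8 + double (double (double (double k))))
    ≡⟨ ρ-8k+8 (double k) ⟩
  ρ (4 + double (double (double k))) ℙ.+ ρ (4 + double (double (double (double k))))
    ≡⟨ cong₂ ℙ._+_ (ρ-8k+4 k) (ρ-8k+4 (double k)) ⟩
  cycle₀₁₁₀ k ℙ.+ cycle₀₁₁₀ (double k)
    ≡⟨ cycle₀₁₁₀-+-double k ⟩
  lookup (0ℙ ∷ 0ℙ ∷ 1ℙ ∷ 1ℙ ∷ []) (k mod 4)
    ∎

ρ-32k : ∀ k → ρ (double (double (double (double (double k))))) ≡ ρ (double (double (double (double k))))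
ρ-32k zero    = refl
ρ-32k (suc k) = begin
  ρ (32 + double (double (double (double (double k)))))
    ≡⟨ ρ-8k+8 (3 + double (double k)) ⟩
  ρ (16 + d⁴k) ℙ.+ ρ (4 + double (double (double (3 + double (double k)))))
    ≡⟨ cong (ρ (16 + d⁴k) ℙ.+_) (trans (ρ-8k+4 (3 + double (double k))) (cycle₀₁₁₀-4k+3 k)) ⟩
  ρ (16 + d⁴k) ℙ.+ 0ℙ
    ≡⟨ ℙ.+-identityʳ (ρ (16 + d⁴k)) ⟩
  ρ (16 + d⁴k)
    ∎
  where
  d⁴k : ℕ
  d⁴k = double (double (double (double k)))

ρ-32k+16 : ∀ k → ρ (16 + double (double (double (double (double k)))))
               ≡ ρ (8 + double (double (double (double k)))) ⁻¹
ρ-32k+16 k = begin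
  ρ (16 + double (double (double (double (double k)))))
    ≡⟨ ρ-8k+8 (1 + double (double k)) ⟩
  ρ (8 + d⁴k) ℙ.+ ρ (4 + double (double (double (1 + double (double k)))))
    ≡⟨ cong (ρ (8 + d⁴k) ℙ.+_) (trans (ρ-8k+4 (1 + double (double k))) (cycle₀₁₁₀-4k+1 k)) ⟩
  ρ (8 + d⁴k) ℙ.+ 1ℙ
    ≡⟨ ℙ.+-comm (ρ (8 + d⁴k)) 1ℙ ⟩
  ρ (8 + d⁴k) ⁻¹
    ∎
  where
  d⁴k : ℕ
  d⁴k = double (double (double (double k)))

toℕ : Parity → ℕ
toℕ 0ℙ = 0
toℕ 1ℙ = 1

%2≡toℕ∘parity : ∀ n → n % 2 ≡ toℕ (parity n)
%2≡toℕ∘parity 0 = refl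
%2≡toℕ∘parity 1 = refl
%2≡toℕ∘parity (suc (suc n)) = %2≡toℕ∘parity n

toℕ-⁻¹ : ∀ p → toℕ (p ⁻¹) ≡ 1 ∸ toℕ p
toℕ-⁻¹ 0ℙ = refl
toℕ-⁻¹ 1ℙ = refl

r≡toℕ∘ρ : ∀ n → r n ≡ toℕ (ρ n)
r≡toℕ∘ρ n = %2≡toℕ∘parity (h n)

r-lookup : ∀ {l} (v : Vec Parity l) i {m n} → m ≡ n → ρ n ≡ lookup v i → r m ≡ lookup (map toℕ v) i
r-lookup v i {n = n} refl eq = trans (r≡toℕ∘ρ n) (trans (cong toℕ eq) (sym (lookup-map i toℕ v)))

r-≡ : ∀ {m m′ n n′} → m ≡ m′ → n ≡ n′ → ρ m′ ≡ ρ n′ → r m ≡ r n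
r-≡ {m′ = m′} {n′ = n′} refl refl eq = trans (r≡toℕ∘ρ m′) (trans (cong toℕ eq) (sym (r≡toℕ∘ρ n′)))

r-⁻¹ : ∀ {m m′ n n′} → m ≡ m′ → n ≡ n′ → ρ m′ ≡ ρ n′ ⁻¹ → r m ≡ 1 ∸ r n
r-⁻¹ {m′ = m′} {n′ = n′} refl refl eq =
  trans (r≡toℕ∘ρ m′) (trans (cong toℕ eq) (trans (toℕ-⁻¹ (ρ n′)) (cong (1 ∸_) (sym (r≡toℕ∘ρ n′)))))

constant-step⇒linear : ∀ a (f : ℕ → ℕ) → f 0 ≡ 0 → (∀ n → f (suc n) ≡ a + f n) → ∀ n → a * n ≡ f n
constant-step⇒linear a f f0≡0 step zero    = trans (*-zeroʳ a) (sym f0≡0)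
constant-step⇒linear a f f0≡0 step (suc n) = begin
  a * suc n  ≡⟨ *-suc a n ⟩
  a + a * n  ≡⟨ cong (a +_) (constant-step⇒linear a f f0≡0 step n) ⟩
  a + f n    ≡⟨ sym (step n) ⟩
  f (suc n)  ∎

+-offset : ∀ c {m n} → m ≡ n → m + c ≡ c + n
+-offset c {m} refl = +-comm m c

theorem3p9 : (∀ n → r (8 * n + 4) ≡ lookup (0 ∷ 1 ∷ 1 ∷ 0 ∷ []) (n mod 4))
    × (∀ n → r (16 * n + 8) ≡ lookup (0 ∷ 0 ∷ 1 ∷ 1 ∷ []) (n mod 4))
    × (∀ n → r (8 * n + 2) ≡ 1 ∸ r (8 * n))
    × (∀ n → r (8 * n + 6) ≡ r (8 * n + 4))
    × (∀ n → r (32 * n) ≡ r (16 * n))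
    × (∀ n → r (32 * n + 16) ≡ 1 ∸ r (16 * n + 8))
theorem3p9 =
    (λ n → r-lookup (0ℙ ∷ 1ℙ ∷ 1ℙ ∷ 0ℙ ∷ []) (n mod 4) (+-offset 4 (8* n)) (ρ-8k+4 n))
  , (λ n → r-lookup (0ℙ ∷ 0ℙ ∷ 1ℙ ∷ 1ℙ ∷ []) (n mod 4) (+-offset 8 (16* n)) (ρ-16k+8 n))
  , (λ n → r-⁻¹ (+-offset 2 (8* n)) (8* n) (ρ-8k+2 n))
  , (λ n → r-≡ (+-offset 6 (8* n)) (+-offset 4 (8* n)) (ρ-8k+6 n))
  , (λ n → r-≡ (32* n) (16* n) (ρ-32k n))
  , (λ n → r-⁻¹ (+-offset 16 (32* n)) (+-offset 8 (16* n)) (ρ-32k+16 n))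
  where
  8* : ∀ n → 8 * n ≡ double (double (double n))
  8* = constant-step⇒linear 8 _ refl (λ _ → refl)
  16* : ∀ n → 16 * n ≡ double (double (double (double n)))
  16* = constant-step⇒linear 16 _ refl (λ _ → refl)
  32* : ∀ n → 32 * n ≡ double (double (double (double (double n))))
  32* = constant-step⇒linear 32 _ refl (λ _ → refl)
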